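{- Let $H_1,H_2\in\Theta$. If for every $X\in\Gamma$, every $T\subseteq\Phi(X)$ and every $v\in\Phi(X)$ the formula $T\to v$ holds in $H_1$ if and only if it holds in $H_2$, then $H_1$ and $H_2$ are LG-equivalent.
   Context: Fix a variety $\Theta$, an infinite set of variables $X^0$, and let $\Gamma$ be the set of finite subsets of $X^0$; $W(X)$ is the free algebra of $\Theta$ over $X$. For $H\in\Theta$, $\mathrm{Hal}^X_\Theta(H)$ is the Boolean algebra of subsets of $\mathrm{Hom}(W(X),H)$ with quantifiers ($\mu\in\exists xA$ iff some $\nu\in A$ agrees with $\mu$ off $x$), equalities $[w\equiv w']_H=\{\mu:\mu(w)=\mu(w')\}$ and maps $s_*(A)=\{\mu:\mu\circ s\in A\}$ for homomorphisms $s:W(X)\to W(Y)$. The multi-sorted algebra of formulas $\Phi=(\Phi(X),X\in\Gamma)$ is the free Halmos algebra (multi-sorted algebras with sorts extended Boolean algebras with quantifiers $\exists x$, equalities $w\equiv w'$, and operations $s_*$, satisfying the Halmos axioms) over the sets of formal equalities $w\equiv w'$, $w,w'\in W(X)$; $\mathrm{Val}^X_H:\Phi(X)\to\mathrm{Hal}^X_\Theta(H)$ are the components of the unique homomorphism sending $w\equiv w'$ to $[w\equiv w']_H$. A point $\mu:W(X)\to H$ satisfies $u$ iff $\mu\in\mathrm{Val}^X_H(u)$; $\mathrm{LKer}(\mu)$ is the set of formulas satisfied by $\mu$. For $T\subseteq\Phi(X)$, $T^L_H=\{\mu:T\subseteq\mathrm{LKer}(\mu)\}$, for $A\subseteq\mathrm{Hom}(W(X),H)$,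 $A^L_H=\bigcap_{\mu\in A}\mathrm{LKer}(\mu)$, and $T^{LL}_H=(T^L_H)^L_H$. The formula $T\to v$ holds in $H$ iff every point satisfying all $u\in T$ satisfies $v$. $H_1,H_2$ are LG-equivalent iff $T^{LL}_{H_1}=T^{LL}_{H_2}$ for all $X\in\Gamma$ and all $T\subseteq\Phi(X)$. -}

module Defs where

open import Data.Nat using (ℕ)
open import Data.Fin using (Fin)
open import Data.Product using (Σ; _×_)
open import Data.Sum using (_⊎_)
open import Data.Empty using (⊥)
open import Data.Unit using (⊤)
open import Relation.Nullary using (¬_)
open import Relation.Binary.PropositionalEquality using (_≡_; _≢_)

record Signature : Set₁ where
  field
    Op    : Set
    arity : Op → ℕ

module _ (Σs : Signature) where
  open Signature Σs

  -- Terms over a set of variables V (representatives of elements of W(V)).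
  data Term (V : Set) : Set where
    var : V → Term V
    op  : (f : Op) → (Fin (arity f) → Term V) → Term V

record Variety : Set₁ where
  field
    sig : Signature
    Ids : Set
    lhs : Ids → Term sig ℕ
    rhs : Ids → Term sig ℕ

module _ {Σs : Signature} where
  open Signature Σs

  record Algebra : Set₁ where
    field
      Carrier : Set
      interp  : (f : Op) → (Fin (arity f) → Carrier) → Carrier

  eval : (A : Algebra) {V : Set} → (V → Algebra.Carrier A) → Term Σs V → Algebra.Carrier A
  eval A ρ (var x)   = ρ x
  eval A ρ (op f ts) = Algebra.interp A f (λ i → eval A ρ (ts i))

record Model (Θ : Variety) : Set₁ where
  open Variety Θ
  field
    alg       : Algebra {sig}
    satisfies : (e : Ids) (ρ : ℕ → Algebra.Carrier alg) →
                eval alg ρ (lhs e) ≡ eval alg ρ (rhs e)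
  open Algebra alg public

-- Formulas Φ(X), X = Fin n (a finite set of n variables), generated from
-- the formal equalities w ≡ w' by the Halmos-algebra operations.
-- s : Fin m → Term (Fin n) encodes the homomorphism s : W(X) → W(Y),
-- and s * u ∈ Φ(Y) for u ∈ Φ(X).

module _ (Θ : Variety) where
  open Variety Θ

  data Φ : ℕ → Set where
    _≐_  : ∀ {n} → Term sig (Fin n) → Term sig (Fin n) → Φ n
    ⊤f   : ∀ {n} → Φ n
    ⊥f   : ∀ {n} → Φ n
    ¬f_  : ∀ {n} → Φ n → Φ n
    _∧f_ : ∀ {n} → Φ n → Φ n → Φ n
    _∨f_ : ∀ {n} → Φ n → Φ n → Φ n
    ∃f   : ∀ {n} → Fin n → Φ n → Φ n
    _*f_ : ∀ {m n} → (Fin m → Term sig (Fin n)) → Φ m → Φ n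

module _ {Θ : Variety} (H : Model Θ) where
  open Variety Θ
  open Model H

  -- points μ : W(X) → H, given by their values on the variables
  Point : ℕ → Set
  Point n = Fin n → Carrier

  Sat : ∀ {n} → Point n → Φ Θ n → Set
  Sat μ (w ≐ w')  = eval alg μ w ≡ eval alg μ w'
  Sat μ ⊤f        = ⊤
  Sat μ ⊥f        = ⊥
  Sat μ (¬f u)    = ¬ Sat μ u
  Sat μ (u ∧f v)  = Sat μ u × Sat μ v
  Sat μ (u ∨f v)  = Sat μ u ⊎ Sat μ v
  Sat μ (∃f x u)  = Σ (Point _) (λ ν → ((y : Fin _) → y ≢ x → ν y ≡ μ y) × Sat ν u)
  Sat μ (s *f u)  = Sat (λ x → eval alg μ (s x)) u

  LKer : ∀ {n} → Point n → Φ Θ n → Set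
  LKer μ u = Sat μ u

  _ᴸ : ∀ {n} → (Φ Θ n → Set) → Point n → Set
  (T ᴸ) μ = ∀ u → T u → LKer μ u

  _ᴸᴾ : ∀ {n} → (Point n → Set) → Φ Θ n → Set
  (A ᴸᴾ) u = ∀ μ → A μ → LKer μ u

  _ᴸᴸ : ∀ {n} → (Φ Θ n → Set) → Φ Θ n → Set
  T ᴸᴸ = (T ᴸ) ᴸᴾ

  Holds : ∀ {n} → (Φ Θ n → Set) → Φ Θ n → Set
  Holds T v = ∀ μ → (∀ u → T u → Sat μ u) → Sat μ v

_↔′_ : Set → Set → Set
P ↔′ Q = (P → Q) × (Q → P)

LG-equivalent : {Θ : Variety} → Model Θ → Model Θ → Set₁
LG-equivalent {Θ} H₁ H₂ =
  ∀ (n : ℕ) (T : Φ Θ n → Set) (v : Φ Θ n) → _ᴸᴸ H₁ T v ↔′ _ᴸᴸ H₂ T v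

module Submission where

open import Defs
open import Data.Nat using (ℕ)
open import Data.Product using (_,_)

ᴸᴸ⇔Holds : {Θ : Variety} (H : Model Θ) {n : ℕ} (T : Φ Θ n → Set) (v : Φ Θ n) →
           _ᴸᴸ H T v ↔′ Holds H T v
ᴸᴸ⇔Holds H T v = (λ v∈Tᴸᴸ → v∈Tᴸᴸ) , (λ T→v → T→v)

↔′-trans : {P Q R : Set} → P ↔′ Q → Q ↔′ R → P ↔′ R
↔′-trans (p→q , q→p) (q→r , r→q) = (λ p → q→r (p→q p)) , (λ r → q→p (r→q r))

↔′-sym : {P Q : Set} → P ↔′ Q → Q ↔′ P
↔′-sym (p→q , q→p) = q→p , p→q

proposition3p5 : (Θ : Variety) (H₁ H₂ : Model Θ) →
    ((n : ℕ) (T : Φ Θ n → Set) (v : Φ Θ n) → Holds H₁ T v ↔′ Holds H₂ T v) →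
    LG-equivalent H₁ H₂
proposition3p5 Θ H₁ H₂ same-implications n T v =
  ↔′-trans (ᴸᴸ⇔Holds H₁ T v)
    (↔′-trans (same-implications n T v) (↔′-sym (ᴸᴸ⇔Holds H₂ T v)))
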